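{- Let $\nu$ be a lattice path and $T,T'$ be $\nu$-trees. Then the join of $T$ and $T'$ in the rotation lattice of $\nu$-trees is $T\vee T'=\overleftarrow{\overleftarrow{T}\wedge\overleftarrow{T'}}$, where the meet $\wedge$ is taken in the rotation lattice of $\overleftarrow{\nu}$-trees.
   Context: A lattice path $\nu$ is a finite sequence of unit north ($\mathsf{N}$) and east ($\mathsf{E}$) steps; $\overleftarrow{\nu}$ is the path obtained by reading $\nu$ backwards and exchanging $\mathsf{N}$ and $\mathsf{E}$. $F_\nu$ is the Ferrers diagram weakly above $\nu$ inside the smallest axis-parallel rectangle containing $\nu$, $A_\nu$ its lattice points. Points of $A_\nu$ are $\nu$-incompatible if one lies strictly southwest of the other and the smallest axis-parallel rectangle containing them lies in $F_\nu$; a $\nu$-tree is an inclusion-maximal set of pairwise $\nu$-compatible points; its root is the top-left corner of $A_\nu$. For a $\nu$-tree $T$, $\overleftarrow{T}$ is its reflection in the line of slope $-1$ through the root; it is an $\overleftarrow{\nu}$-tree. Right rotation: $T'=(T\setminus\{q\})\cup\{q'\}$ where $p,q,r\in T$, $q$ strictly below $p$ in its column, $r$ strictly right of $q$ in its row, $q'$ in the column of $r$ and row of $p$, no other point of $T$ on $[p,q],[q,r]$ and no other point of $T'$ on $[p,q'],[q',r]$. The rotation lattice of $\nu$-trees is the poset on $\nu$-trees generated by $T<T'$ when $T'$ is a right rotation of $T$ (it is a lattice). -}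

module Defs where

open import Data.Nat using (ℕ; zero; suc; _≤_; _<_; _∸_)
open import Data.List using (List; []; _∷_; reverse; map; length; filter)
open import Data.Product using (Σ; _×_; _,_; proj₁; proj₂; ∃)
open import Data.Sum using (_⊎_)
open import Relation.Binary.PropositionalEquality using (_≡_; _≢_)
open import Relation.Binary.Construct.Closure.ReflexiveTransitive using (Star)
open import Relation.Nullary using (¬_)

data Step : Set where
  N E : Step

LatticePath : Set
LatticePath = List Step

swapStep : Step → Step
swapStep N = E
swapStep E = N

revPath : LatticePath → LatticePath
revPath ν = map swapStep (reverse ν)

#E : LatticePath → ℕ
#E [] = 0
#E (N ∷ s) = #E s
#E (E ∷ s) = suc (#E s)

#N : LatticePath → ℕ
#N [] = 0
#N (N ∷ s) = suc (#N s)
#N (E ∷ s) = #N s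

-- Coordinates: ν starts at the origin (0,0), so its bounding rectangle is
-- [0, #E ν] × [0, #N ν], and the root (top-left corner) is (0 , #N ν).
Point : Set
Point = ℕ × ℕ

xc : Point → ℕ
xc = proj₁

yc : Point → ℕ
yc = proj₂

-- lowest height of ν on the vertical line at abscissa x
-- (= number of N steps before the x-th E step; 0 for x = 0)
low : LatticePath → ℕ → ℕ
low s zero = 0
low [] (suc x) = 0
low (N ∷ s) (suc x) = suc (low s (suc x))
low (E ∷ s) (suc x) = low s x

-- A_ν : lattice points of the Ferrers diagram F_ν (weakly above ν inside
-- the bounding rectangle)
InA : LatticePath → Point → Set
InA ν (x , y) = (x ≤ #E ν) × (y ≤ #N ν) × (low ν x ≤ y)

StrictSW : Point → Point → Set
StrictSW (x₁ , y₁) (x₂ , y₂) = (x₁ < x₂) × (y₁ < y₂)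

-- the smallest axis-parallel rectangle spanned by p (SW) and q (NE) lies in
-- F_ν (for lattice rectangles: all its lattice points lie in A_ν)
RectInF : LatticePath → Point → Point → Set
RectInF ν (x₁ , y₁) (x₂ , y₂) =
  ∀ x y → x₁ ≤ x → x ≤ x₂ → y₁ ≤ y → y ≤ y₂ → InA ν (x , y)

Incompatible : LatticePath → Point → Point → Set
Incompatible ν p q =
  (StrictSW p q × RectInF ν p q) ⊎ (StrictSW q p × RectInF ν q p)

PointSet : Set₁
PointSet = Point → Set

_⊆ₚ_ : PointSet → PointSet → Set
S ⊆ₚ T = ∀ p → S p → T p

_≐ₚ_ : PointSet → PointSet → Set
S ≐ₚ T = (S ⊆ₚ T) × (T ⊆ₚ S)

CompatibleSet : LatticePath → PointSet → Set
CompatibleSet ν S = (S ⊆ₚ InA ν) × (∀ p q → S p → S q → ¬ Incompatible ν p q)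

IsTree : LatticePath → PointSet → Set₁
IsTree ν T = CompatibleSet ν T × (∀ S → CompatibleSet ν S → T ⊆ₚ S → S ⊆ₚ T)

-- ←T : reflection in the line of slope -1 through the root (0 , #N ν),
-- expressed in the coordinates of ←ν (whose root is (0 , #E ν)):
-- (x , y) ↦ (#N ν ∸ y , #E ν ∸ x).
revTree : LatticePath → PointSet → PointSet
revTree ν T (x' , y') = (x' ≤ #N ν) × (y' ≤ #E ν) × T (#E ν ∸ y' , #N ν ∸ x')

-- Right rotation: T' = (T ∖ {q}) ∪ {q'}
RightRotation : PointSet → PointSet → Set
RightRotation T T' =
  Σ Point λ p → Σ Point λ q → Σ Point λ r →
    T p × T q × T r ×
    (xc q ≡ xc p) × (yc q < yc p) ×
    (yc r ≡ yc q) × (xc q < xc r) ×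
    (∀ s → T s → xc s ≡ xc p → yc q ≤ yc s → yc s ≤ yc p → (s ≡ p) ⊎ (s ≡ q)) ×
    (∀ s → T s → yc s ≡ yc q → xc q ≤ xc s → xc s ≤ xc r → (s ≡ q) ⊎ (s ≡ r)) ×
    (∀ s → T' s → yc s ≡ yc p → xc p ≤ xc s → xc s ≤ xc r
        → (s ≡ p) ⊎ (s ≡ (xc r , yc p))) ×
    (∀ s → T' s → xc s ≡ xc r → yc r ≤ yc s → yc s ≤ yc p
        → (s ≡ (xc r , yc p)) ⊎ (s ≡ r)) ×
    (∀ s → T' s → (T s × s ≢ q) ⊎ (s ≡ (xc r , yc p))) ×
    (∀ s → (T s × s ≢ q) ⊎ (s ≡ (xc r , yc p)) → T' s)

-- one generating step of the rotation order on ν-trees (sets are taken up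
-- to extensional equality)
RotStep : LatticePath → PointSet → PointSet → Set₁
RotStep ν T T' = IsTree ν T × IsTree ν T' × ((T ≐ₚ T') ⊎ RightRotation T T')

_⊢_≤rot_ : LatticePath → PointSet → PointSet → Set₁
ν ⊢ T ≤rot T' = Star (RotStep ν) T T'

IsJoin : LatticePath → PointSet → PointSet → PointSet → Set₁
IsJoin ν T T' J =
  IsTree ν J × (ν ⊢ T ≤rot J) × (ν ⊢ T' ≤rot J) ×
  (∀ U → IsTree ν U → ν ⊢ T ≤rot U → ν ⊢ T' ≤rot U → ν ⊢ J ≤rot U)

IsMeet : LatticePath → PointSet → PointSet → PointSet → Set₁
IsMeet ν T T' M =
  IsTree ν M × (ν ⊢ M ≤rot T) × (ν ⊢ M ≤rot T') ×
  (∀ U → IsTree ν U → ν ⊢ U ≤rot T → ν ⊢ U ≤rot T' → ν ⊢ U ≤rot M)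

module Submission where

open import Defs
open import Data.Nat using (ℕ; zero; suc; _+_; _≤_; _∸_; z≤n; s≤s)
open import Data.Nat.Properties
open import Data.List using (List; []; _∷_; _++_; reverse; map; [_])
open import Data.List.Properties using (reverse-++; map-++; reverse-map; unfold-reverse; reverse-involutive)
open import Data.Product using (Σ; _×_; _,_; proj₁; proj₂; swap)
open import Data.Product.Properties using (≡-dec)
open import Data.Sum using (_⊎_; inj₁; inj₂)
import Data.Sum as Sum
open import Data.Empty using (⊥-elim)
open import Relation.Binary.PropositionalEquality hiding ([_])
open import Relation.Nullary using (¬_; yes; no)
open import Function using (_∘′_)
open import Relation.Binary.Construct.Closure.ReflexiveTransitive using (ε; _◅_; _◅◅_)

-- The reflection T ↦ ←T sends ν-trees to ←ν-trees, the reflection back is its inverse, and it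
-- turns a right rotation T → T' into a right rotation ←T' → ←T. Hence it is an order-reversing
-- bijection between the two rotation lattices, and such a bijection exchanges meets and joins.
-- That reflection maps A_ν onto A_←ν comes from splitting paths: (x , y) lies in F_ν iff ν = α ++ β
-- with the vertex (#E α , #N α) weakly south-east of (x , y), and then ←ν = ←β ++ ←α has its
-- vertex (#N β , #E β) weakly south-east of the reflected point.

m+n≡o+p∧m≤o⇒p≤n : ∀ {m n o p} → m + n ≡ o + p → m ≤ o → p ≤ n
m+n≡o+p∧m≤o⇒p≤n {m} {n} {o} {p} eq m≤o =
  +-cancelˡ-≤ m p n (≤-trans (+-monoˡ-≤ p m≤o) (≤-reflexive (sym eq)))

m≤o∸n⇒n≤o∸m : ∀ {m n o} → n ≤ o → m ≤ o ∸ n → n ≤ o ∸ m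
m≤o∸n⇒n≤o∸m {m} {n} {o} n≤o m≤o∸n =
  m+n≤o⇒m≤o∸n n (subst (_≤ o) (+-comm m n) (m≤o∸n⇒m+n≤o m n≤o m≤o∸n))

o∸n≤m⇒o∸m≤n : ∀ {m n o} → m ≤ o → o ∸ n ≤ m → o ∸ m ≤ n
o∸n≤m⇒o∸m≤n {m} {n} {o} m≤o le =
  ∸-cancelʳ-≤ (m∸n≤m o m) (subst (o ∸ n ≤_) (sym (m∸[m∸n]≡n m≤o)) le)

additive-reverse : ∀ {A : Set} (f : List A → ℕ) → (∀ xs ys → f (xs ++ ys) ≡ f xs + f ys) →
                   ∀ xs → f (reverse xs) ≡ f xs
additive-reverse f f-++ [] = refl
additive-reverse f f-++ (x ∷ xs) = begin
  f (reverse (x ∷ xs))     ≡⟨ cong f (unfold-reverse x xs) ⟩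
  f (reverse xs ++ [ x ])  ≡⟨ f-++ (reverse xs) [ x ] ⟩
  f (reverse xs) + f [ x ] ≡⟨ cong (_+ f [ x ]) (additive-reverse f f-++ xs) ⟩
  f xs + f [ x ]           ≡⟨ +-comm (f xs) (f [ x ]) ⟩
  f [ x ] + f xs           ≡⟨ sym (f-++ [ x ] xs) ⟩
  f (x ∷ xs)               ∎
  where open ≡-Reasoning

#N-++ : ∀ α β → #N (α ++ β) ≡ #N α + #N β
#N-++ [] β = refl
#N-++ (N ∷ α) β = cong suc (#N-++ α β)
#N-++ (E ∷ α) β = #N-++ α β

#E-++ : ∀ α β → #E (α ++ β) ≡ #E α + #E β
#E-++ [] β = refl
#E-++ (N ∷ α) β = #E-++ α β
#E-++ (E ∷ α) β = cong suc (#E-++ α β)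

#N-map-swapStep : ∀ ν → #N (map swapStep ν) ≡ #E ν
#N-map-swapStep [] = refl
#N-map-swapStep (N ∷ ν) = #N-map-swapStep ν
#N-map-swapStep (E ∷ ν) = cong suc (#N-map-swapStep ν)

#E-map-swapStep : ∀ ν → #E (map swapStep ν) ≡ #N ν
#E-map-swapStep [] = refl
#E-map-swapStep (N ∷ ν) = cong suc (#E-map-swapStep ν)
#E-map-swapStep (E ∷ ν) = #E-map-swapStep ν

#N-revPath : ∀ ν → #N (revPath ν) ≡ #E ν
#N-revPath ν = trans (#N-map-swapStep (reverse ν)) (additive-reverse #E #E-++ ν)

#E-revPath : ∀ ν → #E (revPath ν) ≡ #N ν
#E-revPath ν = trans (#E-map-swapStep (reverse ν)) (additive-reverse #N #N-++ ν)

revPath-++ : ∀ α β → revPath (α ++ β) ≡ revPath β ++ revPath α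
revPath-++ α β =
  trans (cong (map swapStep) (reverse-++ α β)) (map-++ swapStep (reverse β) (reverse α))

map-swapStep-involutive : ∀ ν → map swapStep (map swapStep ν) ≡ ν
map-swapStep-involutive [] = refl
map-swapStep-involutive (N ∷ ν) = cong (N ∷_) (map-swapStep-involutive ν)
map-swapStep-involutive (E ∷ ν) = cong (E ∷_) (map-swapStep-involutive ν)

revPath-involutive : ∀ ν → revPath (revPath ν) ≡ ν
revPath-involutive ν = begin
  map swapStep (reverse (map swapStep (reverse ν)))
    ≡⟨ cong (map swapStep) (sym (reverse-map swapStep (reverse ν))) ⟩
  map swapStep (map swapStep (reverse (reverse ν)))
    ≡⟨ cong (λ ν′ → map swapStep (map swapStep ν′)) (reverse-involutive ν) ⟩
  map swapStep (map swapStep ν)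
    ≡⟨ map-swapStep-involutive ν ⟩
  ν ∎
  where open ≡-Reasoning

low-mono : ∀ ν {x x′} → x ≤ x′ → low ν x ≤ low ν x′
low-mono ν {zero} _ = z≤n
low-mono [] {suc x} {suc x′} _ = z≤n
low-mono (N ∷ ν) {suc x} {suc x′} x≤x′ = s≤s (low-mono ν x≤x′)
low-mono (E ∷ ν) {suc x} {suc x′} (s≤s x≤x′) = low-mono ν x≤x′

rectInF-fromCorner : ∀ ν {x₁ y₁ x₂ y₂} → InA ν (x₂ , y₁) → y₂ ≤ #N ν → RectInF ν (x₁ , y₁) (x₂ , y₂)
rectInF-fromCorner ν (x₂≤ , _ , low≤) y₂≤ x y _ x≤x₂ y₁≤y y≤y₂ =
  ≤-trans x≤x₂ x₂≤ , ≤-trans y≤y₂ y₂≤ , ≤-trans (low-mono ν x≤x₂) (≤-trans low≤ y₁≤y)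

SouthEastVertex : LatticePath → Point → Set
SouthEastVertex ν (x , y) =
  Σ LatticePath λ α → Σ LatticePath λ β → (ν ≡ α ++ β) × (x ≤ #E α) × (#N α ≤ y)

low≤⇒southEastVertex : ∀ ν {x y} → x ≤ #E ν → low ν x ≤ y → SouthEastVertex ν (x , y)
low≤⇒southEastVertex ν {zero} _ _ = [] , ν , refl , z≤n , z≤n
low≤⇒southEastVertex (N ∷ ν) {suc x} {suc y} x≤ (s≤s low≤) with low≤⇒southEastVertex ν x≤ low≤
... | α , β , refl , x≤#Eα , #Nα≤y = N ∷ α , β , refl , x≤#Eα , s≤s #Nα≤y
low≤⇒southEastVertex (E ∷ ν) {suc x} (s≤s x≤) low≤ with low≤⇒southEastVertex ν x≤ low≤
... | α , β , refl , x≤#Eα , #Nα≤y = E ∷ α , β , refl , s≤s x≤#Eα , #Nα≤y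

low-++≤ : ∀ α β {x y} → x ≤ #E α → #N α ≤ y → low (α ++ β) x ≤ y
low-++≤ α β {zero} _ _ = z≤n
low-++≤ (N ∷ α) β {suc x} {suc y} x≤ (s≤s ≤y) = s≤s (low-++≤ α β x≤ ≤y)
low-++≤ (E ∷ α) β {suc x} (s≤s x≤) ≤y = low-++≤ α β x≤ ≤y

southEastVertex⇒low≤ : ∀ {ν x y} → SouthEastVertex ν (x , y) → low ν x ≤ y
southEastVertex⇒low≤ (α , β , refl , x≤#Eα , #Nα≤y) = low-++≤ α β x≤#Eα #Nα≤y

southEastVertex-revPath : ∀ {ν x y x′ y′} → x + y′ ≡ #E ν → y + x′ ≡ #N ν →
                          SouthEastVertex ν (x , y) → SouthEastVertex (revPath ν) (x′ , y′)
southEastVertex-revPath ex ey (α , β , refl , x≤#Eα , #Nα≤y) =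
  revPath β , revPath α , revPath-++ α β ,
  subst (_ ≤_) (sym (#E-revPath β)) (m+n≡o+p∧m≤o⇒p≤n (trans (sym (#N-++ α β)) (sym ey)) #Nα≤y) ,
  subst (_≤ _) (sym (#N-revPath β)) (m+n≡o+p∧m≤o⇒p≤n (trans ex (#E-++ α β)) x≤#Eα)

InA-revPath : ∀ ν {x y x′ y′} → x + y′ ≡ #E ν → y + x′ ≡ #N ν →
              InA ν (x , y) → InA (revPath ν) (x′ , y′)
InA-revPath ν {x} {y} {x′} {y′} ex ey (_ , _ , low≤) =
  ≤-trans (m≤n+m x′ y) (≤-reflexive (trans ey (sym (#E-revPath ν)))) ,
  ≤-trans (m≤n+m y′ x) (≤-reflexive (trans ex (sym (#N-revPath ν)))) ,
  southEastVertex⇒low≤ (southEastVertex-revPath ex ey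
    (low≤⇒southEastVertex ν (≤-trans (m≤m+n x y′) (≤-reflexive ex)) low≤))

-- An abstraction of the pair (ν , ←ν), symmetric in its arguments, which avoids transporting
-- along the merely propositional equation ←←ν ≡ ν.
record Reflection (ν μ : LatticePath) : Set where
  field
    #N≡#E : #N μ ≡ #E ν
    #E≡#N : #E μ ≡ #N ν
    InA-reflect  : ∀ {x y x′ y′} → x + y′ ≡ #E ν → y + x′ ≡ #N ν →
                   InA ν (x , y) → InA μ (x′ , y′)
    InA-reflect⁻ : ∀ {x y x′ y′} → x + y′ ≡ #E ν → y + x′ ≡ #N ν →
                   InA μ (x′ , y′) → InA ν (x , y)

revPath-reflection : ∀ ν → Reflection ν (revPath ν)
revPath-reflection ν = record
  { #N≡#E = #N-revPath ν
  ; #E≡#N = #E-revPath ν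
  ; InA-reflect = InA-revPath ν
  ; InA-reflect⁻ = λ {x} {y} {x′} {y′} ex ey →
      subst (λ ν′ → InA ν′ (x , y)) (revPath-involutive ν) ∘′
      InA-revPath (revPath ν)
        (trans (+-comm x′ y) (trans ey (sym (#E-revPath ν))))
        (trans (+-comm y′ x) (trans ex (sym (#N-revPath ν))))
  }

reflection-sym : ∀ {ν μ} → Reflection ν μ → Reflection μ ν
reflection-sym {ν} {μ} ρ = record
  { #N≡#E = sym #E≡#N
  ; #E≡#N = sym #N≡#E
  ; InA-reflect = λ {x} {y} {x′} {y′} ex ey →
      InA-reflect⁻ (swapped y x′ ey #N≡#E) (swapped x y′ ex #E≡#N)
  ; InA-reflect⁻ = λ {x} {y} {x′} {y′} ex ey →
      InA-reflect (swapped y x′ ey #N≡#E) (swapped x y′ ex #E≡#N)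
  }
  where
  open Reflection ρ
  swapped : ∀ m n {o p} → m + n ≡ o → o ≡ p → n + m ≡ p
  swapped m n eq o≡p = trans (+-comm n m) (trans eq o≡p)

OnlyEndsVertical : PointSet → ℕ → ℕ → ℕ → Set
OnlyEndsVertical T x y₁ y₂ =
  ∀ s → T s → xc s ≡ x → y₁ ≤ yc s → yc s ≤ y₂ → (s ≡ (x , y₂)) ⊎ (s ≡ (x , y₁))

OnlyEndsHorizontal : PointSet → ℕ → ℕ → ℕ → Set
OnlyEndsHorizontal T y x₁ x₂ =
  ∀ s → T s → yc s ≡ y → x₁ ≤ xc s → xc s ≤ x₂ → (s ≡ (x₁ , y)) ⊎ (s ≡ (x₂ , y))

Exchange : PointSet → Point → Point → PointSet → Set
Exchange T q q′ T′ =
  (∀ s → T′ s → (T s × s ≢ q) ⊎ (s ≡ q′)) × (∀ s → (T s × s ≢ q) ⊎ (s ≡ q′) → T′ s)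

exchange-sym : ∀ {T T′ q q′} → T q → ¬ T q′ → Exchange T q q′ T′ → Exchange T′ q′ q T
exchange-sym {T} {T′} {q} {q′} Tq q′∉T (T′⊆ , ⊆T′) = T⊆ , ⊆T
  where
  T⊆ : ∀ s → T s → (T′ s × s ≢ q′) ⊎ (s ≡ q)
  T⊆ s Ts with ≡-dec _≟_ _≟_ s q
  ... | yes s≡q = inj₂ s≡q
  ... | no s≢q = inj₁ (⊆T′ s (inj₁ (Ts , s≢q)) , λ s≡q′ → q′∉T (subst T s≡q′ Ts))
  ⊆T : ∀ s → (T′ s × s ≢ q′) ⊎ (s ≡ q) → T s
  ⊆T s (inj₂ refl) = Tq
  ⊆T s (inj₁ (T′s , s≢q′)) with T′⊆ s T′s
  ... | inj₁ (Ts , _) = Ts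
  ... | inj₂ s≡q′ = ⊥-elim (s≢q′ s≡q′)

InBox : LatticePath → Point → Set
InBox ν (x , y) = (x ≤ #E ν) × (y ≤ #N ν)

InA⇒InBox : ∀ {ν p} → InA ν p → InBox ν p
InA⇒InBox (x≤ , y≤ , _) = x≤ , y≤

reflect : LatticePath → Point → Point
reflect ν (x , y) = (#N ν ∸ y , #E ν ∸ x)

-- revTree ν X p holds iff p lies in the transposed bounding box and X (unreflect ν p)
unreflect : LatticePath → Point → Point
unreflect ν (x′ , y′) = (#E ν ∸ y′ , #N ν ∸ x′)

revTree-mono : ∀ ν {X Y} → X ⊆ₚ Y → revTree ν X ⊆ₚ revTree ν Y
revTree-mono ν X⊆Y (x′ , y′) (x′≤ , y′≤ , Xp) = x′≤ , y′≤ , X⊆Y _ Xp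

module _ {ν : LatticePath} where

  unreflect-reflect : ∀ {p} → InBox ν p → unreflect ν (reflect ν p) ≡ p
  unreflect-reflect (x≤ , y≤) = cong₂ _,_ (m∸[m∸n]≡n x≤) (m∸[m∸n]≡n y≤)

  reflect-unreflect : ∀ {x′ y′} → x′ ≤ #N ν → y′ ≤ #E ν → reflect ν (unreflect ν (x′ , y′)) ≡ (x′ , y′)
  reflect-unreflect x′≤ y′≤ = cong₂ _,_ (m∸[m∸n]≡n x′≤) (m∸[m∸n]≡n y′≤)

  unreflect≡⇒≡reflect : ∀ {x′ y′ p} → x′ ≤ #N ν → y′ ≤ #E ν →
                        unreflect ν (x′ , y′) ≡ p → (x′ , y′) ≡ reflect ν p
  unreflect≡⇒≡reflect x′≤ y′≤ refl = sym (reflect-unreflect x′≤ y′≤)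

  ≡reflect⇒unreflect≡ : ∀ {s p} → InBox ν p → s ≡ reflect ν p → unreflect ν s ≡ p
  ≡reflect⇒unreflect≡ p∈ refl = unreflect-reflect p∈

  ∈-revTree : ∀ {X : PointSet} {p} → X p → InBox ν p → revTree ν X (reflect ν p)
  ∈-revTree {X} {x , y} Xp p∈ = m∸n≤m _ y , m∸n≤m _ x , subst X (sym (unreflect-reflect p∈)) Xp

  onlyEndsVertical-reflect : ∀ {T x y₁ y₂} → x ≤ #E ν → y₁ ≤ #N ν → OnlyEndsVertical T x y₁ y₂ →
                             OnlyEndsHorizontal (revTree ν T) (#E ν ∸ x) (#N ν ∸ y₂) (#N ν ∸ y₁)
  onlyEndsVertical-reflect x≤ y₁≤ ends (x′ , _) (x′≤ , y′≤ , Ts) refl lo hi =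
    Sum.map (unreflect≡⇒≡reflect x′≤ y′≤) (unreflect≡⇒≡reflect x′≤ y′≤)
      (ends _ Ts (m∸[m∸n]≡n x≤) (m≤o∸n⇒n≤o∸m y₁≤ hi) (o∸n≤m⇒o∸m≤n x′≤ lo))

  onlyEndsHorizontal-reflect : ∀ {T y x₁ x₂} → y ≤ #N ν → x₁ ≤ #E ν → OnlyEndsHorizontal T y x₁ x₂ →
                               OnlyEndsVertical (revTree ν T) (#N ν ∸ y) (#E ν ∸ x₂) (#E ν ∸ x₁)
  onlyEndsHorizontal-reflect y≤ x₁≤ ends (_ , y′) (x′≤ , y′≤ , Ts) refl lo hi =
    Sum.map (unreflect≡⇒≡reflect x′≤ y′≤) (unreflect≡⇒≡reflect x′≤ y′≤)
      (ends _ Ts (m∸[m∸n]≡n y≤) (m≤o∸n⇒n≤o∸m x₁≤ hi) (o∸n≤m⇒o∸m≤n y′≤ lo))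

  exchange-reflect : ∀ {T T′ q q′} → InBox ν q → InBox ν q′ → Exchange T q q′ T′ →
                     Exchange (revTree ν T) (reflect ν q) (reflect ν q′) (revTree ν T′)
  exchange-reflect {T} {T′} {q} {q′} q∈ q′∈ (T′⊆ , ⊆T′) = rT′⊆ , ⊆rT′
    where
    rT′⊆ : ∀ s → revTree ν T′ s → (revTree ν T s × s ≢ reflect ν q) ⊎ (s ≡ reflect ν q′)
    rT′⊆ (x′ , y′) (x′≤ , y′≤ , T′s) with T′⊆ _ T′s
    ... | inj₁ (Ts , s≢q) = inj₁ ((x′≤ , y′≤ , Ts) , λ e → s≢q (≡reflect⇒unreflect≡ q∈ e))
    ... | inj₂ s≡q′ = inj₂ (unreflect≡⇒≡reflect x′≤ y′≤ s≡q′)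
    ⊆rT′ : ∀ s → (revTree ν T s × s ≢ reflect ν q) ⊎ (s ≡ reflect ν q′) → revTree ν T′ s
    ⊆rT′ (x′ , y′) (inj₁ ((x′≤ , y′≤ , Ts) , s≢q)) =
      x′≤ , y′≤ , ⊆T′ _ (inj₁ (Ts , λ e → s≢q (unreflect≡⇒≡reflect x′≤ y′≤ e)))
    ⊆rT′ _ (inj₂ refl) = ∈-revTree {X = T′} (⊆T′ q′ (inj₂ refl)) q′∈

  rightRotation-reflect : ∀ {A B} → CompatibleSet ν A → RightRotation A B →
                          RightRotation (revTree ν B) (revTree ν A)
  rightRotation-reflect {A} {B} (A⊆InA , A-compat)
    ((xp , yp) , (_ , yq) , (xr , _) , Ap , Aq , Ar , refl , yq<yp , refl , xp<xr ,
     pq , qr , pq′ , q′r , exch)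
    -- ←p, ←q′, ←r play the roles of p, q, r, and ←q becomes the new point
    = reflect ν (xp , yp) , reflect ν (xr , yp) , reflect ν (xr , yq)
    , ∈-revTree {X = B} Bp p∈ , ∈-revTree {X = B} Bq′ q′∈ , ∈-revTree {X = B} Br r∈
    , refl , ∸-monoʳ-< xp<xr (proj₁ r∈) , refl , ∸-monoʳ-< yq<yp (proj₂ p∈)
    , onlyEndsHorizontal-reflect (proj₂ p∈) (proj₁ p∈) pq′
    , onlyEndsVertical-reflect (proj₁ r∈) (proj₂ q∈) q′r
    , onlyEndsVertical-reflect (proj₁ p∈) (proj₂ q∈) pq
    , onlyEndsHorizontal-reflect (proj₂ q∈) (proj₁ p∈) qr
    , exchange-reflect q′∈ q∈ (exchange-sym Aq q′∉A exch)
    where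
    p∈ = InA⇒InBox (A⊆InA _ Ap)
    q∈ = InA⇒InBox (A⊆InA _ Aq)
    r∈ = InA⇒InBox (A⊆InA _ Ar)
    q′∈ : InBox ν (xr , yp)
    q′∈ = proj₁ r∈ , proj₂ p∈
    Bp : B (xp , yp)
    Bp = proj₂ exch _ (inj₁ (Ap , λ e → <-irrefl (sym (cong yc e)) yq<yp))
    Br : B (xr , yq)
    Br = proj₂ exch _ (inj₁ (Ar , λ e → <-irrefl (sym (cong xc e)) xp<xr))
    Bq′ : B (xr , yp)
    Bq′ = proj₂ exch _ (inj₂ refl)
    q′∉A : ¬ A (xr , yp)
    q′∉A Aq′ = A-compat _ _ Aq Aq′
      (inj₁ ((xp<xr , yq<yp) , rectInF-fromCorner ν (A⊆InA _ Ar) (proj₂ p∈)))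

module _ {ν μ : LatticePath} (ρ : Reflection ν μ) where
  open Reflection ρ

  revTree-InA : ∀ {X} → X ⊆ₚ InA ν → revTree ν X ⊆ₚ InA μ
  revTree-InA X⊆InA (x′ , y′) (x′≤ , y′≤ , Xp) =
    InA-reflect (m∸n+n≡m y′≤) (m∸n+n≡m x′≤) (X⊆InA _ Xp)

  southWestRect-unreflect : ∀ {a₁ b₁ a₂ b₂} → a₁ ≤ #N ν → b₁ ≤ #E ν → a₂ ≤ #N ν → b₂ ≤ #E ν →
    StrictSW (a₁ , b₁) (a₂ , b₂) × RectInF μ (a₁ , b₁) (a₂ , b₂) →
    StrictSW (unreflect ν (a₂ , b₂)) (unreflect ν (a₁ , b₁)) ×
    RectInF ν (unreflect ν (a₂ , b₂)) (unreflect ν (a₁ , b₁))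
  southWestRect-unreflect {a₁} {b₁} {a₂} {b₂} a₁≤ b₁≤ a₂≤ b₂≤ ((a₁<a₂ , b₁<b₂) , rect) =
    (∸-monoʳ-< b₁<b₂ b₂≤ , ∸-monoʳ-< a₁<a₂ a₂≤) , rect′
    where
    rect′ : RectInF ν (unreflect ν (a₂ , b₂)) (unreflect ν (a₁ , b₁))
    rect′ x y lx ux ly uy =
      InA-reflect⁻ (m+[n∸m]≡n x≤) (m+[n∸m]≡n y≤)
        (rect (#N ν ∸ y) (#E ν ∸ x)
          (m≤o∸n⇒n≤o∸m a₁≤ uy) (o∸n≤m⇒o∸m≤n y≤ ly) (m≤o∸n⇒n≤o∸m b₁≤ ux) (o∸n≤m⇒o∸m≤n x≤ lx))
      where
      x≤ : x ≤ #E ν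
      x≤ = ≤-trans ux (m∸n≤m _ b₁)
      y≤ : y ≤ #N ν
      y≤ = ≤-trans uy (m∸n≤m _ a₁)

  revTree-compatible : ∀ {X} → CompatibleSet ν X → CompatibleSet μ (revTree ν X)
  revTree-compatible {X} (X⊆InA , X-compat) = revTree-InA X⊆InA , rX-compat
    where
    rX-compat : ∀ s t → revTree ν X s → revTree ν X t → ¬ Incompatible μ s t
    rX-compat (a₁ , b₁) (a₂ , b₂) (a₁≤ , b₁≤ , Xs) (a₂≤ , b₂≤ , Xt) (inj₁ st) =
      X-compat _ _ Xs Xt (inj₂ (southWestRect-unreflect a₁≤ b₁≤ a₂≤ b₂≤ st))
    rX-compat (a₁ , b₁) (a₂ , b₂) (a₁≤ , b₁≤ , Xs) (a₂≤ , b₂≤ , Xt) (inj₂ ts) =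
      X-compat _ _ Xs Xt (inj₁ (southWestRect-unreflect a₂≤ b₂≤ a₁≤ b₁≤ ts))

  revTree-involutive : ∀ {X} → X ⊆ₚ InA ν → revTree μ (revTree ν X) ≐ₚ X
  revTree-involutive {X} X⊆InA = rrX⊆X , X⊆rrX
    where
    rrX⊆X : revTree μ (revTree ν X) ⊆ₚ X
    rrX⊆X (x , y) (x≤ , y≤ , _ , _ , Xp) rewrite #N≡#E | #E≡#N =
      subst X (cong₂ _,_ (m∸[m∸n]≡n x≤) (m∸[m∸n]≡n y≤)) Xp
    X⊆rrX : X ⊆ₚ revTree μ (revTree ν X)
    X⊆rrX (x , y) Xp rewrite #N≡#E | #E≡#N with X⊆InA _ Xp
    ... | x≤ , y≤ , _ =
      x≤ , y≤ , m∸n≤m _ y , m∸n≤m _ x , subst X (sym (cong₂ _,_ (m∸[m∸n]≡n x≤) (m∸[m∸n]≡n y≤))) Xp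

module _ {ν μ : LatticePath} (ρ : Reflection ν μ) where
  private
    ρ⁻ : Reflection μ ν
    ρ⁻ = reflection-sym ρ

  revTree-isTree : ∀ {T} → IsTree ν T → IsTree μ (revTree ν T)
  revTree-isTree {T} (T-compat , T-maximal) = revTree-compatible ρ T-compat , rT-maximal
    where
    rT-maximal : ∀ S → CompatibleSet μ S → revTree ν T ⊆ₚ S → S ⊆ₚ revTree ν T
    rT-maximal S S-compat rT⊆S s Ss =
      revTree-mono ν (T-maximal (revTree μ S) (revTree-compatible ρ⁻ S-compat) T⊆rS)
        s (proj₂ (revTree-involutive ρ⁻ (proj₁ S-compat)) s Ss)
      where
      T⊆rS : T ⊆ₚ revTree μ S
      T⊆rS t Tt = revTree-mono μ rT⊆S t (proj₂ (revTree-involutive ρ (proj₁ T-compat)) t Tt)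

  revTree-rotStep : ∀ {A B} → RotStep ν A B → RotStep μ (revTree ν B) (revTree ν A)
  revTree-rotStep (A-tree , B-tree , inj₁ (A⊆B , B⊆A)) =
    revTree-isTree B-tree , revTree-isTree A-tree , inj₁ (revTree-mono ν B⊆A , revTree-mono ν A⊆B)
  revTree-rotStep (A-tree , B-tree , inj₂ rotation) =
    revTree-isTree B-tree , revTree-isTree A-tree ,
    inj₂ (rightRotation-reflect (proj₁ A-tree) rotation)

  revTree-antitone : ∀ {A B} → ν ⊢ A ≤rot B → μ ⊢ revTree ν B ≤rot revTree ν A
  revTree-antitone ε = ε
  revTree-antitone (step ◅ steps) = revTree-antitone steps ◅◅ (revTree-rotStep step ◅ ε)

module _ {ν μ : LatticePath} (ρ : Reflection ν μ) where
  private
    rrX-tree : ∀ {X} → IsTree ν X → IsTree ν (revTree μ (revTree ν X))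
    rrX-tree X-tree = revTree-isTree (reflection-sym ρ) (revTree-isTree ρ X-tree)

  ≤rot-revTree² : ∀ {X} → IsTree ν X → ν ⊢ X ≤rot revTree μ (revTree ν X)
  ≤rot-revTree² X-tree = (X-tree , rrX-tree X-tree , inj₁ (swap X≐rrX)) ◅ ε
    where X≐rrX = revTree-involutive ρ (proj₁ (proj₁ X-tree))

  revTree²-≤rot : ∀ {X} → IsTree ν X → ν ⊢ revTree μ (revTree ν X) ≤rot X
  revTree²-≤rot X-tree = (rrX-tree X-tree , X-tree , inj₁ rrX≐X) ◅ ε
    where rrX≐X = revTree-involutive ρ (proj₁ (proj₁ X-tree))

proposition4p13 : (ν : LatticePath) (T T' M : PointSet) →
    IsTree ν T → IsTree ν T' →
    IsMeet (revPath ν) (revTree ν T) (revTree ν T') M →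
    IsJoin ν T T' (revTree (revPath ν) M)
proposition4p13 ν T T' M T-tree T'-tree (M-tree , M≤rT , M≤rT' , M-greatest) =
  revTree-isTree ρ⁻ M-tree , above T-tree M≤rT , above T'-tree M≤rT' , least
  where
  μ = revPath ν
  ρ = revPath-reflection ν
  ρ⁻ = reflection-sym ρ

  above : ∀ {X} → IsTree ν X → μ ⊢ M ≤rot revTree ν X → ν ⊢ X ≤rot revTree μ M
  above X-tree M≤rX = ≤rot-revTree² ρ X-tree ◅◅ revTree-antitone ρ⁻ M≤rX

  least : ∀ U → IsTree ν U → ν ⊢ T ≤rot U → ν ⊢ T' ≤rot U → ν ⊢ revTree μ M ≤rot U
  least U U-tree T≤U T'≤U =
    revTree-antitone ρ⁻ (M-greatest (revTree ν U) (revTree-isTree ρ U-tree)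
                                    (revTree-antitone ρ T≤U) (revTree-antitone ρ T'≤U))
    ◅◅ revTree²-≤rot ρ U-tree
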